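{- Let $F(X,Y)$ be a CNF formula, $C$ a quantified clause of $F$ (i.e. $C$ contains a variable of $X$), and $(\vec{q},U,C)$ a D-sequent that holds for $\exists X[F]$. Let $F'$ be obtained from $F$ by adding clauses implied by $F$. Then $(\vec{q},U,C)$ also holds for $\exists X[F']$.
   Context: Formulas are CNF over Boolean variables, viewed as sets of clauses; $X,Y$ are disjoint variable sets. For an assignment $\vec{q}$ and clause $C$, $C_{\vec{q}}=1$ if $\vec{q}$ satisfies $C$, otherwise $C_{\vec{q}}$ is $C$ with falsified literals removed; $F_{\vec{q}}$ removes satisfied clauses and replaces each other clause $C$ by $C_{\vec{q}}$. Formulas $G\equiv H$ if they agree under every full assignment to their free variables. A clause $C$ is redundant in $\exists X[F]$ if $\exists X[F]\equiv\exists X[F\setminus\{C\}]$. A D-sequent is a triple $(\vec{q},U,C)$ with $\vec{q}$ an assignment, $U$ a set of clauses and $C$ a clause; it holds for $\exists X[F]$ if $C_{\vec{q}}$ is redundant in $\exists X[F_{\vec{q}}]$. -}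

module Defs where

open import Data.Nat using (ℕ; _≡ᵇ_)
open import Data.Bool using (Bool; true; false; not; _∧_; _∨_; if_then_else_)
open import Data.Bool.Properties using () renaming (_≟_ to _≟B_)
open import Data.Maybe using (Maybe; just; nothing)
open import Data.List using (List; []; _∷_; filterᵇ; mapMaybe)
open import Data.Bool.ListAction using (any; all)
open import Data.List.Relation.Unary.All using (All)
open import Data.List.Relation.Unary.Any using (Any)
open import Data.Product using (Σ; _×_; _,_; proj₁; proj₂)
open import Data.Sum using (_⊎_)
open import Data.Empty using (⊥)
open import Relation.Binary.PropositionalEquality using (_≡_)
open import Relation.Nullary.Decidable using (does)
open import Function.Bundles using (_⇔_)

Var : Set
Var = ℕ

-- A literal is a variable with a polarity: (v , true) is v, (v , false) is ¬v.
Literal : Set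
Literal = Var × Bool

var : Literal → Var
var = proj₁

-- A clause is a disjunction of literals (a finite list, read as a set).
Clause : Set
Clause = List Literal

-- A CNF formula is a finite list of clauses (read as a set of clauses).
CNF : Set
CNF = List Clause

litEq : Literal → Literal → Bool
litEq (v , b) (w , c) = (v ≡ᵇ w) ∧ does (b ≟B c)

memLit : Literal → Clause → Bool
memLit l D = any (litEq l) D

subClause : Clause → Clause → Bool
subClause C D = all (λ l → memLit l D) C

sameClause : Clause → Clause → Bool
sameClause C D = subClause C D ∧ subClause D C

Assignment : Set
Assignment = Var → Bool

litVal : Assignment → Literal → Bool
litVal τ (v , b) = does (τ v ≟B b)

clauseVal : Assignment → Clause → Bool
clauseVal τ C = any (litVal τ) C

cnfVal : Assignment → CNF → Bool
cnfVal τ F = all (clauseVal τ) F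

-- Partial assignments: nothing = unassigned.
PAssignment : Set
PAssignment = Var → Maybe Bool

pSat : PAssignment → Literal → Bool
pSat q (v , b) with q v
... | nothing = false
... | just c = does (c ≟B b)

pFree : PAssignment → Literal → Bool
pFree q (v , b) with q v
... | nothing = true
... | just _ = false

-- C_q : nothing stands for the constant 1 (C satisfied by q);
-- otherwise the clause with the literals falsified by q removed.
restrictClause : PAssignment → Clause → Maybe Clause
restrictClause q C =
  if any (pSat q) C then nothing else just (filterᵇ (pFree q) C)

restrictCNF : PAssignment → CNF → CNF
restrictCNF q F = mapMaybe (restrictClause q) F

removeClause : CNF → Clause → CNF
removeClause F C = filterᵇ (λ D → not (sameClause D C)) F

-- F ∖ {C_q} where C_q may be the constant 1 (which is not a clause of F_q).
removeMClause : CNF → Maybe Clause → CNF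
removeMClause F nothing = F
removeMClause F (just C) = removeClause F C

VarSet : Set₁
VarSet = Var → Set

Disjoint : VarSet → VarSet → Set
Disjoint X Y = ∀ v → X v → Y v → ⊥

OverVars : VarSet → VarSet → CNF → Set
OverVars X Y F = All (All (λ l → X (var l) ⊎ Y (var l))) F

Quantified : VarSet → Clause → Set
Quantified X C = Any (λ l → X (var l)) C

-- Value of ∃X[G] under a full assignment σ of the free variables Y
-- (σ is a total assignment; only its values on Y matter).
ExistsSat : VarSet → VarSet → CNF → Assignment → Set
ExistsSat X Y G σ = Σ Assignment λ τ → (∀ v → Y v → τ v ≡ σ v) × (cnfVal τ G ≡ true)

QEquiv : VarSet → VarSet → CNF → CNF → Set
QEquiv X Y G H = ∀ (σ : Assignment) → ExistsSat X Y G σ ⇔ ExistsSat X Y H σ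

RedundantM : VarSet → VarSet → Maybe Clause → CNF → Set
RedundantM X Y C F = QEquiv X Y F (removeMClause F C)

record DSequent : Set where
  constructor dseq
  field
    asg : PAssignment
    U   : CNF
    cl  : Clause

Holds : VarSet → VarSet → DSequent → CNF → Set
Holds X Y (dseq q U C) F = RedundantM X Y (restrictClause q C) (restrictCNF q F)

Implies : CNF → Clause → Set
Implies F D = ∀ (τ : Assignment) → cnfVal τ F ≡ true → clauseVal τ D ≡ true

{-# OPTIONS --safe #-}
-- Extending a full assignment τ by the partial assignment q gives an assignment that satisfies F
-- exactly when τ satisfies F_q.  Hence F ⊨ G yields F_q ⊨ G_q, and clauses entailed by F_q can be
-- added without affecting the redundancy of C_q: a model of (F ++ G)_q ∖ C_q is a model of
-- F_q ∖ C_q, redundancy turns it into a model of F_q with the same values on Y, and that model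
-- also satisfies G_q.
module Submission where

open import Defs
open import Data.List using (_++_)
open import Data.List.Relation.Unary.All using (All)
open import Data.List.Membership.Propositional using (_∈_)

open import Data.Bool using (Bool; true; false; not; _∧_; _∨_; T?)
open import Data.Bool.ListAction using (any; all)
open import Data.Bool.Properties using (∧-assoc; ∧-conicalˡ; ∧-conicalʳ; ∨-assoc; ∨-zeroʳ) renaming (_≟_ to _≟B_)
open import Data.List using ([]; _∷_; filterᵇ)
open import Data.List.Properties using (filter-++; mapMaybe-++)
open import Data.List.Relation.Unary.All using ([]; _∷_)
open import Data.Maybe using (just; nothing; fromMaybe)
open import Data.Product using (_,_)
open import Function using (_∘_)
open import Function.Bundles using (mk⇔; Equivalence)
open import Relation.Binary.PropositionalEquality using (_≡_; refl; sym; trans; cong; subst)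
open import Relation.Nullary.Decidable using (does)

infix 4 _⊨_

_⊨_ : Assignment → CNF → Set
τ ⊨ F = cnfVal τ F ≡ true

Entails : CNF → CNF → Set
Entails F G = ∀ τ → τ ⊨ F → τ ⊨ G

cnfVal-++ : ∀ τ (A B : CNF) → cnfVal τ (A ++ B) ≡ cnfVal τ A ∧ cnfVal τ B
cnfVal-++ τ []      B = refl
cnfVal-++ τ (D ∷ A) B =
  trans (cong (clauseVal τ D ∧_) (cnfVal-++ τ A B)) (sym (∧-assoc (clauseVal τ D) _ _))

⊨-++⁻ˡ : ∀ τ (A B : CNF) → τ ⊨ A ++ B → τ ⊨ A
⊨-++⁻ˡ τ A B h = ∧-conicalˡ _ _ (trans (sym (cnfVal-++ τ A B)) h)

⊨-++⁺ : ∀ τ (A B : CNF) → τ ⊨ A → τ ⊨ B → τ ⊨ A ++ B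
⊨-++⁺ τ A B hA hB = trans (cnfVal-++ τ A B) (subst (λ b → b ∧ cnfVal τ B ≡ true) (sym hA) hB)

Implies⇒Entails : ∀ {F G} → All (Implies F) G → Entails F G
Implies⇒Entails          []       τ hF = refl
Implies⇒Entails {F} {_} (i ∷ is) τ hF rewrite i τ hF = Implies⇒Entails {F} is τ hF

removeMClause-++ : ∀ (A B : CNF) c →
                   removeMClause (A ++ B) c ≡ removeMClause A c ++ removeMClause B c
removeMClause-++ A B nothing  = refl
removeMClause-++ A B (just C) = filter-++ (T? ∘ λ D → not (sameClause D C)) A B

all-filterᵇ : ∀ {A : Set} (p f : A → Bool) xs → all p xs ≡ true → all p (filterᵇ f xs) ≡ true
all-filterᵇ p f []       h = refl
all-filterᵇ p f (x ∷ xs) h with f x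
... | true  rewrite ∧-conicalˡ (p x) _ h = all-filterᵇ p f xs (∧-conicalʳ (p x) _ h)
... | false = all-filterᵇ p f xs (∧-conicalʳ (p x) _ h)

removeMClause-entailed : ∀ (A : CNF) c → Entails A (removeMClause A c)
removeMClause-entailed A nothing  τ h = h
removeMClause-entailed A (just C) τ h = all-filterᵇ (clauseVal τ) _ A h

extend : PAssignment → Assignment → Assignment
extend q τ v = fromMaybe (τ v) (q v)

clauseVal-extend : ∀ q τ D →
                   clauseVal (extend q τ) D ≡ any (pSat q) D ∨ clauseVal τ (filterᵇ (pFree q) D)
clauseVal-extend q τ [] = refl
clauseVal-extend q τ ((v , b) ∷ D) with q v
... | just c  =
  trans (cong (does (c ≟B b) ∨_) (clauseVal-extend q τ D)) (sym (∨-assoc (does (c ≟B b)) _ _))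
... | nothing with does (τ v ≟B b)
...   | true  = sym (∨-zeroʳ _)
...   | false = clauseVal-extend q τ D

cnfVal-extend : ∀ q τ F → cnfVal (extend q τ) F ≡ cnfVal τ (restrictCNF q F)
cnfVal-extend q τ []      = refl
cnfVal-extend q τ (D ∷ F) rewrite clauseVal-extend q τ D with any (pSat q) D
... | true  = cnfVal-extend q τ F
... | false = cong (clauseVal τ (filterᵇ (pFree q) D) ∧_) (cnfVal-extend q τ F)

restrictCNF-entails : ∀ q F G → Entails F G → Entails (restrictCNF q F) (restrictCNF q G)
restrictCNF-entails q F G F⊨G τ τ⊨Fq =
  trans (sym (cnfVal-extend q τ G)) (F⊨G (extend q τ) (trans (cnfVal-extend q τ F) τ⊨Fq))

ExistsSat-mono : ∀ X Y A B → Entails A B → ∀ σ → ExistsSat X Y A σ → ExistsSat X Y B σ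
ExistsSat-mono X Y A B A⊨B σ (τ , agree , τ⊨A) = τ , agree , A⊨B τ τ⊨A

RedundantM-++-entailed : ∀ X Y c (H K : CNF) → Entails H K →
                         RedundantM X Y c H → RedundantM X Y c (H ++ K)
RedundantM-++-entailed X Y c H K H⊨K redundant σ = mk⇔
  (ExistsSat-mono X Y (H ++ K) (removeMClause (H ++ K) c) (removeMClause-entailed (H ++ K) c) σ)
  (ExistsSat-mono X Y H (H ++ K) H⊨H++K σ
    ∘ Equivalence.from (redundant σ)
    ∘ ExistsSat-mono X Y (removeMClause (H ++ K) c) (removeMClause H c) H++K∖c⊨H∖c σ)
  where
  H⊨H++K : Entails H (H ++ K)
  H⊨H++K τ τ⊨H = ⊨-++⁺ τ H K τ⊨H (H⊨K τ τ⊨H)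

  H++K∖c⊨H∖c : Entails (removeMClause (H ++ K) c) (removeMClause H c)
  H++K∖c⊨H∖c τ h =
    ⊨-++⁻ˡ τ (removeMClause H c) (removeMClause K c) (subst (τ ⊨_) (removeMClause-++ H K c) h)

lemma1 : (X Y : VarSet) → Disjoint X Y → (F : CNF) → OverVars X Y F → (C : Clause) → C ∈ F → Quantified X C → (q : PAssignment) → (U : CNF) → Holds X Y (dseq q U C) F → (G : CNF) → All (Implies F) G → OverVars X Y G → Holds X Y (dseq q U C) (F ++ G)
lemma1 X Y _ F _ C _ _ q U holds G implied _ =
  subst (RedundantM X Y (restrictClause q C)) (sym (mapMaybe-++ (restrictClause q) F G))
    (RedundantM-++-entailed X Y (restrictClause q C) (restrictCNF q F) (restrictCNF q G)
      (restrictCNF-entails q F G (Implies⇒Entails {F} implied)) holds)
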